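{- Let $D$ be a northwest diagram and $i$ a row index such that the set of columns occupied by row $i$ of $D$ is contained in the set of columns occupied by row $i+1$. Then $s_iD$ is northwest and $s_iD\in\mathrm{KD}(D)$. In particular $\mathrm{KD}(s_iD)\subseteq\mathrm{KD}(D)$.
   Context: A diagram is a finite set of cells $(i,j)\in\mathbb{Z}_{>0}^2$ ($i$ row, $j$ column), rows numbered top to bottom. $D$ is northwest if whenever $(j,k),(i,l)\in D$ with $i<j$, $k<l$, then $(i,k)\in D$. $s_iD$ is the diagram obtained from $D$ by exchanging rows $i$ and $i+1$. A Kohnert move selects the rightmost cell of a row and moves it up (toward row 1) within its column to the first empty position above it, jumping over cells, if one exists; $\mathrm{KD}(D)$ is the set of diagrams reachable from $D$ by Kohnert moves (including $D$). -}

module Defs where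

open import Data.Nat using (ℕ; suc; _<_; _≟_)
open import Data.Product using (_×_; _,_; Σ; ∃)
open import Data.Sum using (_⊎_)
open import Data.List using (List; map; filter; _∷_)
open import Data.List.Membership.Propositional using (_∈_; _∉_)
open import Relation.Nullary using (¬_; yes; no)
open import Relation.Binary.PropositionalEquality using (_≡_)
open import Function.Bundles using (_⇔_)

-- A cell (r , c): r = row (rows numbered from the top), c = column.
-- Convention: indices start at 0 instead of 1 (harmless shift of Z_{>0}).
Cell : Set
Cell = ℕ × ℕ

-- A diagram: a finite set of cells, represented by a list (duplicates / order
-- irrelevant; diagrams are compared up to extensional equality _≈D_).
Diagram : Set
Diagram = List Cell

_∈D_ : Cell → Diagram → Set
x ∈D D = x ∈ D

_≈D_ : Diagram → Diagram → Set
D ≈D E = ∀ x → (x ∈D D) ⇔ (x ∈D E)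

Northwest : Diagram → Set
Northwest D = ∀ i j k l → (j , k) ∈D D → (i , l) ∈D D → i < j → k < l → (i , k) ∈D D

swapRow : ℕ → ℕ → ℕ
swapRow i r with r ≟ i
... | yes _ = suc i
... | no _ with r ≟ suc i
...   | yes _ = i
...   | no _ = r

s : ℕ → Diagram → Diagram
s i D = map (λ { (r , c) → (swapRow i r , c) }) D

-- Kohnert move: (r , c) is the rightmost cell of row r in D; r' < r is the
-- first empty position of column c above (r , c) (all positions strictly
-- between r' and r in column c are occupied); E = D - (r , c) + (r' , c).
KohnertMove : Diagram → Diagram → Set
KohnertMove D E =
  Σ ℕ λ r → Σ ℕ λ c → Σ ℕ λ r' →
    ((r , c) ∈D D)
  × (∀ c' → c < c' → (r , c') ∉ D)
  × (r' < r)
  × ((r' , c) ∉ D)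
  × (∀ r'' → r' < r'' → r'' < r → (r'' , c) ∈D D)
  × (∀ x → (x ∈D E) ⇔ ((x ∈D D × ¬ (x ≡ (r , c))) ⊎ (x ≡ (r' , c))))

data KD (D : Diagram) : Diagram → Set where
  here : ∀ {E} → D ≈D E → KD D E
  step : ∀ {E F} → KohnertMove D E → KD E F → KD D F

-- Let M be one past the last column of row i. Working from the right, each cell
-- (i+1, c) with c ≥ M is the rightmost cell of row i+1 and sits directly below
-- an empty position, so one Kohnert move lifts it into row i. After all of
-- them, row i holds row i+1 (as row i ⊆ row i+1), while row i+1 keeps its cells
-- left of M, and by the northwest condition these are exactly row i.
module Submission where

open import Defs
open import Data.Nat using (ℕ; suc; zero; _<_; _≤_; _+_; _≟_; _≤?_)
open import Data.Nat.Properties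
open import Data.Product as Product using (_×_; _,_; ∃₂; proj₁; proj₂)
open import Data.Product.Properties using (≡-dec)
open import Data.Sum as Sum using (_⊎_; inj₁; inj₂; [_,_])
open import Data.List using (map; filter)
open import Data.List.Extrema.Nat using (max; xs≤max; argmax-sel)
open import Data.List.Relation.Unary.All using (lookup)
open import Data.List.Membership.Propositional using (_∉_)
open import Data.List.Membership.Propositional.Properties
  using (∈-map⁺; ∈-map⁻; ∈-filter⁺; ∈-filter⁻)
open import Data.List.Membership.DecPropositional (≡-dec _≟_ _≟_) using (_∈?_)
open import Data.Empty using (⊥-elim)
open import Function using (_∘_; id)
open import Function.Bundles using (_⇔_; mk⇔; Equivalence)
open import Function.Properties.Equivalence using () renaming (sym to ⇔-sym; trans to ⇔-trans)
open import Relation.Nullary using (¬_; yes; no)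
open import Relation.Nullary.Decidable using (_×-dec_)
open import Relation.Unary using (Decidable)
open import Relation.Binary.PropositionalEquality using (_≡_; refl; sym; trans; cong; subst; _≢_)

open Equivalence

private
  variable
    i m r c : ℕ
    x : Cell
    D E F : Diagram

≈D-refl : D ≈D D
≈D-refl _ = mk⇔ id id

≈D-sym : D ≈D E → E ≈D D
≈D-sym D≈E x = ⇔-sym (D≈E x)

≈D-trans : D ≈D E → E ≈D F → D ≈D F
≈D-trans D≈E E≈F x = ⇔-trans (D≈E x) (E≈F x)

KohnertMove-respˡ : D ≈D E → KohnertMove D F → KohnertMove E F
KohnertMove-respˡ D≈E (r , c , r' , top , rightmost , r'<r , empty , gap , result) =
  r , c , r' , to (D≈E _) top , (λ c' c<c' → rightmost c' c<c' ∘ from (D≈E _)) , r'<r ,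
  empty ∘ from (D≈E _) , (λ r'' r'<r'' r''<r → to (D≈E _) (gap r'' r'<r'' r''<r)) ,
  λ x → mk⇔ (Sum.map₁ (Product.map₁ (to (D≈E x))) ∘ to (result x))
            (from (result x) ∘ Sum.map₁ (Product.map₁ (from (D≈E x))))

KD-respˡ : D ≈D E → KD D F → KD E F
KD-respˡ D≈E (here D≈F) = here (≈D-trans (≈D-sym D≈E) D≈F)
KD-respˡ D≈E (step move rest) = step (KohnertMove-respˡ D≈E move) rest

KD-trans : KD D E → KD E F → KD D F
KD-trans (here D≈E) E↝F = KD-respˡ (≈D-sym D≈E) E↝F
KD-trans (step move D↝E) E↝F = step move (KD-trans D↝E E↝F)

data SwapRowView (i : ℕ) : ℕ → ℕ → Set where
  upper : SwapRowView i i (suc i)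
  lower : SwapRowView i (suc i) i
  other : r ≢ i → r ≢ suc i → SwapRowView i r r

swapRow-view : ∀ i r → SwapRowView i r (swapRow i r)
swapRow-view i r with r ≟ i
... | yes refl = upper
... | no r≢i with r ≟ suc i
...   | yes refl = lower
...   | no r≢1+i = other r≢i r≢1+i

swapRow-upper : ∀ i → swapRow i i ≡ suc i
swapRow-upper i with swapRow i i | swapRow-view i i
... | _ | upper = refl
... | _ | other i≢i _ = ⊥-elim (i≢i refl)

swapRow-lower : ∀ i → swapRow i (suc i) ≡ i
swapRow-lower i with swapRow i (suc i) | swapRow-view i (suc i)
... | _ | lower = refl
... | _ | other _ 1+i≢1+i = ⊥-elim (1+i≢1+i refl)

swapRow-other : r ≢ i → r ≢ suc i → swapRow i r ≡ r
swapRow-other {r} {i} r≢i r≢1+i with swapRow i r | swapRow-view i r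
... | _ | upper = ⊥-elim (r≢i refl)
... | _ | lower = ⊥-elim (r≢1+i refl)
... | _ | other _ _ = refl

swapRow-involutive : ∀ i r → swapRow i (swapRow i r) ≡ r
swapRow-involutive i r with swapRow i r | swapRow-view i r
... | _ | upper = swapRow-lower i
... | _ | lower = swapRow-upper i
... | _ | other r≢i r≢1+i = swapRow-other r≢i r≢1+i

∈-s : ∀ {r'} → swapRow i r ≡ r' → (r , c) ∈D s i D ⇔ (r' , c) ∈D D
∈-s {i} {r} {c} {D} {r'} e = mk⇔ unswap swap
  where
  unswap : (r , c) ∈D s i D → (r' , c) ∈D D
  unswap p with ∈-map⁻ _ p
  ... | (r₀ , c) , q , refl =
    subst (λ t → (t , c) ∈D D) (trans (sym (swapRow-involutive i r₀)) e) q
  swap : (r' , c) ∈D D → (r , c) ∈D s i D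
  swap q = subst (λ t → (t , c) ∈D s i D)
    (trans (cong (swapRow i) (sym e)) (swapRow-involutive i r)) (∈-map⁺ _ q)

swapRow-< : ∀ {a j} → a < j → swapRow i a < swapRow i j ⊎ (a ≡ i × j ≡ suc i)
swapRow-< {i} {a} {j} a<j with swapRow i a | swapRow-view i a | swapRow i j | swapRow-view i j
... | _ | upper | _ | upper = ⊥-elim (<-irrefl refl a<j)
... | _ | upper | _ | lower = inj₂ (refl , refl)
... | _ | upper | _ | other _ j≢1+i = inj₁ (≤∧≢⇒< a<j (j≢1+i ∘ sym))
... | _ | lower | _ | upper = ⊥-elim (<-asym a<j (n<1+n i))
... | _ | lower | _ | lower = ⊥-elim (<-irrefl refl a<j)
... | _ | lower | _ | other _ _ = inj₁ (<-trans (n<1+n i) a<j)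
... | _ | other _ _ | _ | upper = inj₁ (<-trans a<j (n<1+n i))
... | _ | other a≢i _ | _ | lower = inj₁ (≤∧≢⇒< (≤-pred a<j) a≢i)
... | _ | other _ _ | _ | other _ _ = inj₁ a<j

northwest-s : Northwest D → (∀ c → (i , c) ∈D D → (suc i , c) ∈D D) → Northwest (s i D)
northwest-s {D} {i} nw row⊆ a j k l jk∈ al∈ a<j k<l with swapRow-< {i} a<j
... | inj₁ a'<j' = from (∈-s refl)
  (nw _ _ k l (to (∈-s refl) jk∈) (to (∈-s refl) al∈) a'<j' k<l)
... | inj₂ (refl , refl) = from (∈-s (swapRow-upper i)) (row⊆ k (to (∈-s (swapRow-lower i)) jk∈))

columnBound : Diagram → ℕ
columnBound D = max 0 (map (suc ∘ proj₂) D)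

<columnBound : (r , c) ∈D D → c < columnBound D
<columnBound p = lookup (xs≤max 0 _) (∈-map⁺ (suc ∘ proj₂) p)

columnBound-attained : ∀ {k} → k < columnBound D → ∃₂ λ r l → (r , l) ∈D D × k ≤ l
columnBound-attained {D} k<bound with argmax-sel id 0 (map (suc ∘ proj₂) D)
... | inj₁ bound≡0 = ⊥-elim (n≮0 (subst (_ <_) bound≡0 k<bound))
... | inj₂ bound∈ with ∈-map⁻ (suc ∘ proj₂) bound∈
...   | (r , l) , rl∈ , bound≡1+l = r , l , rl∈ , ≤-pred (subst (_ <_) bound≡1+l k<bound)

row : ℕ → Diagram → Diagram
row i = filter (λ x → proj₁ x ≟ i)

rowBound : ℕ → Diagram → ℕ
rowBound i D = columnBound (row i D)

<rowBound : (i , c) ∈D D → c < rowBound i D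
<rowBound p = <columnBound (∈-filter⁺ (λ x → proj₁ x ≟ _) p refl)

northwest-<rowBound : Northwest D → (suc i , c) ∈D D → c < rowBound i D → (i , c) ∈D D
northwest-<rowBound {D} {i} {c} nw p c<bound with columnBound-attained c<bound
... | r , l , rl∈row , c≤l with ∈-filter⁻ (λ x → proj₁ x ≟ i) rl∈row | m≤n⇒m<n∨m≡n c≤l
...   | il∈ , refl | inj₁ c<l = nw i (suc i) c l p il∈ (n<1+n i) c<l
...   | il∈ , refl | inj₂ refl = il∈

Rises : ℕ → ℕ → Cell → Set
Rises i m (r , c) = r ≡ suc i × m ≤ c

rises? : ∀ i m → Decidable (Rises i m)
rises? i m (r , c) = r ≟ suc i ×-dec m ≤? c

raiseCell : ℕ → ℕ → Cell → Cell
raiseCell i m x with rises? i m x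
... | yes _ = (i , proj₂ x)
... | no _ = x

raise : ℕ → ℕ → Diagram → Diagram
raise i m = map (raiseCell i m)

data InRaise (i m : ℕ) (D : Diagram) : Cell → Set where
  kept : x ∈D D → ¬ Rises i m x → InRaise i m D x
  raised : m ≤ c → (suc i , c) ∈D D → InRaise i m D (i , c)

∈-raise : x ∈D raise i m D ⇔ InRaise i m D x
∈-raise {x} {i} {m} {D} = mk⇔ ∈⇒InRaise InRaise⇒∈
  where
  ∈⇒InRaise : x ∈D raise i m D → InRaise i m D x
  ∈⇒InRaise p with ∈-map⁻ (raiseCell i m) p
  ... | y , y∈ , refl with rises? i m y
  ...   | yes (refl , m≤c) = raised m≤c y∈
  ...   | no ¬rises = kept y∈ ¬rises
  InRaise⇒∈ : InRaise i m D x → x ∈D raise i m D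
  InRaise⇒∈ (kept {x} x∈ ¬rises) with ∈-map⁺ (raiseCell i m) x∈
  ... | q with rises? i m x
  ...   | yes rises = ⊥-elim (¬rises rises)
  ...   | no _ = q
  InRaise⇒∈ (raised {c} m≤c p) with ∈-map⁺ (raiseCell i m) p
  ... | q with rises? i m (suc i , c)
  ...   | yes _ = q
  ...   | no ¬rises = ⊥-elim (¬rises (refl , m≤c))

raise-≈-self : (∀ c → (suc i , c) ∈D D → c < m) → raise i m D ≈D D
raise-≈-self {i} {D} {m} lowerRow<m x = ⇔-trans ∈-raise (mk⇔ drop (λ x∈ → kept x∈ (¬rises x∈)))
  where
  ¬rises : ∀ {x} → x ∈D D → ¬ Rises i m x
  ¬rises x∈ (refl , m≤c) = <⇒≱ (lowerRow<m _ x∈) m≤c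
  drop : InRaise i m D x → x ∈D D
  drop (kept x∈ _) = x∈
  drop (raised m≤c p) = ⊥-elim (<⇒≱ (lowerRow<m _ p) m≤c)

Rises-suc⇒Rises : Rises i (suc m) x → Rises i m x
Rises-suc⇒Rises {x = r , c} (r≡1+i , m<c) = r≡1+i , <⇒≤ m<c

Rises⇒≡⊎Rises-suc : Rises i m x → x ≡ (suc i , m) ⊎ Rises i (suc m) x
Rises⇒≡⊎Rises-suc {x = r , c} (refl , m≤c) with m≤n⇒m<n∨m≡n m≤c
... | inj₁ m<c = inj₂ (refl , m<c)
... | inj₂ refl = inj₁ refl

∈-raise-suc : x ∈D raise i m D ⇔
  ((x ∈D raise i (suc m) D × x ≢ (suc i , m)) ⊎ (x ≡ (i , m) × (suc i , m) ∈D D))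
∈-raise-suc {x} {i} {m} {D} = ⇔-trans ∈-raise (mk⇔ split merge)
  where
  split : InRaise i m D x →
    (x ∈D raise i (suc m) D × x ≢ (suc i , m)) ⊎ (x ≡ (i , m) × (suc i , m) ∈D D)
  split (kept x∈ ¬rises) =
    inj₁ (from ∈-raise (kept x∈ (¬rises ∘ Rises-suc⇒Rises)) , λ { refl → ¬rises (refl , ≤-refl) })
  split (raised m≤c p) with m≤n⇒m<n∨m≡n m≤c
  ... | inj₁ m<c = inj₁ (from ∈-raise (raised m<c p) , λ ())
  ... | inj₂ refl = inj₂ (refl , p)
  merge : (x ∈D raise i (suc m) D × x ≢ (suc i , m)) ⊎ (x ≡ (i , m) × (suc i , m) ∈D D) →
    InRaise i m D x
  merge (inj₂ (refl , p)) = raised ≤-refl p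
  merge (inj₁ (x∈ , x≢)) with to ∈-raise x∈
  ... | raised m<c p = raised (<⇒≤ m<c) p
  ... | kept x∈D ¬rises-suc = kept x∈D ([ x≢ , ¬rises-suc ] ∘ Rises⇒≡⊎Rises-suc)

∈-raise-lowerRow : (suc i , c) ∈D raise i m D → (suc i , c) ∈D D × c < m
∈-raise-lowerRow p with to ∈-raise p
... | kept p' ¬rises = p' , ≰⇒> (¬rises ∘ (refl ,_))

KohnertMove-adjacent : (suc r , c) ∈D D → (∀ c' → c < c' → (suc r , c') ∉ D) → (r , c) ∉ D →
  (∀ x → x ∈D E ⇔ ((x ∈D D × x ≢ (suc r , c)) ⊎ x ≡ (r , c))) → KohnertMove D E
KohnertMove-adjacent {r} top rightmost empty result =
  suc r , _ , r , top , rightmost , n<1+n r , empty ,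
  (λ _ r<r'' r''<1+r → ⊥-elim (<⇒≱ r<r'' (≤-pred r''<1+r))) , result

KD-raise-suc : (i , m) ∉ D → KD (raise i (suc m) D) (raise i m D)
KD-raise-suc {i} {m} {D} upper∉ with (suc i , m) ∈? D
... | no lower∉ = here λ x → mk⇔
  (λ x∈ → from ∈-raise-suc (inj₁ (x∈ , λ { refl → lower∉ (proj₁ (∈-raise-lowerRow x∈)) })))
  ([ proj₁ , ⊥-elim ∘ lower∉ ∘ proj₂ ] ∘ to ∈-raise-suc)
... | yes lower∈ = step (KohnertMove-adjacent top rightmost empty result) (here ≈D-refl)
  where
  top : (suc i , m) ∈D raise i (suc m) D
  top = from ∈-raise (kept lower∈ (1+n≰n ∘ proj₂))
  rightmost : ∀ c' → m < c' → (suc i , c') ∉ raise i (suc m) D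
  rightmost _ m<c' p = <⇒≱ m<c' (≤-pred (proj₂ (∈-raise-lowerRow p)))
  empty : (i , m) ∉ raise i (suc m) D
  empty p with to ∈-raise p
  ... | kept p' _ = upper∉ p'
  ... | raised 1+m≤m _ = 1+n≰n 1+m≤m
  result : ∀ x → x ∈D raise i m D ⇔ ((x ∈D raise i (suc m) D × x ≢ (suc i , m)) ⊎ x ≡ (i , m))
  result x = ⇔-trans ∈-raise-suc (mk⇔ (Sum.map₂ proj₁) (Sum.map₂ (_, lower∈)))

KD-raise-+ : (∀ c → (i , c) ∈D D → c < m) → ∀ k → KD (raise i (k + m) D) (raise i m D)
KD-raise-+ upperRow<m zero = here ≈D-refl
KD-raise-+ {m = m} upperRow<m (suc k) =
  KD-trans (KD-raise-suc λ p → <⇒≱ (upperRow<m _ p) (m≤n+m m k)) (KD-raise-+ upperRow<m k)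

raise-≈-s : (∀ c → (i , c) ∈D D → (suc i , c) ∈D D) → (∀ c → (i , c) ∈D D → c < m) →
  (∀ c → (suc i , c) ∈D D → c < m → (i , c) ∈D D) → raise i m D ≈D s i D
raise-≈-s {i} {D} {m} row⊆ upperRow<m lowerRow<m⇒upper (a , b) =
  ⇔-trans ∈-raise (⇔-trans (swapped (swapRow-view i a)) (⇔-sym (∈-s refl)))
  where
  raised-or-kept : (suc i , b) ∈D D → InRaise i m D (i , b)
  raised-or-kept p with m ≤? b
  ... | yes m≤b = raised m≤b p
  ... | no m≰b = kept (lowerRow<m⇒upper b p (≰⇒> m≰b)) λ { (() , _) }
  swapped : ∀ {a r} → SwapRowView i a r → InRaise i m D (a , b) ⇔ (r , b) ∈D D
  swapped upper = mk⇔ (λ { (kept p _) → row⊆ b p ; (raised _ p) → p }) raised-or-kept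
  swapped lower = mk⇔
    (λ { (kept p ¬rises) → lowerRow<m⇒upper b p (≰⇒> (¬rises ∘ (refl ,_))) })
    (λ p → kept (row⊆ b p) (<⇒≱ (upperRow<m b p) ∘ proj₂))
  swapped (other a≢i a≢1+i) = mk⇔
    (λ { (kept p _) → p ; (raised _ _) → ⊥-elim (a≢i refl) })
    (λ p → kept p (a≢1+i ∘ proj₁))

s∈KD : Northwest D → (∀ c → (i , c) ∈D D → (suc i , c) ∈D D) → KD D (s i D)
s∈KD {D} {i} nw row⊆ =
  KD-respˡ (raise-≈-self lowerRow<start)
    (KD-trans (KD-raise-+ upperRow<M (columnBound D))
      (here (raise-≈-s row⊆ upperRow<M (λ _ → northwest-<rowBound nw))))
  where
  M : ℕ
  M = rowBound i D
  upperRow<M : ∀ c → (i , c) ∈D D → c < M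
  upperRow<M _ = <rowBound
  lowerRow<start : ∀ c → (suc i , c) ∈D D → c < columnBound D + M
  lowerRow<start _ p = <-≤-trans (<columnBound p) (m≤m+n _ M)

lemma2p17 : (D : Diagram) (i : ℕ) → Northwest D
    → (∀ c → (i , c) ∈D D → (suc i , c) ∈D D)
    → Northwest (s i D) × KD D (s i D) × (∀ E → KD (s i D) E → KD D E)
lemma2p17 D i nw row⊆ = northwest-s nw row⊆ , s∈KD nw row⊆ , λ _ → KD-trans (s∈KD nw row⊆)
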